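{- Let $\lambda$ be a shape, $S$ its set of segments, $X\in\mathrm{Bic}(S)$, and $c$ a SE-corner of $\lambda$. Then the set $X\setminus c$ of segments in $X$ that are segments of the shape $\lambda\setminus c$ is a biclosed set of segments of $\lambda\setminus c$.
   Context: A shape is a finite induced subgraph $\lambda$ of the square grid graph on $\mathbb{Z}\times\mathbb{Z}$; North means increasing second coordinate, East increasing first coordinate. A vertex $v$ of $\lambda$ is interior if all nine points $v+(a,b)$, $a,b\in\{ -1,0,1\}$, are vertices of $\lambda$. A vertex $c$ of $\lambda$ is a SE-corner if neither $c+(0,-1)$ nor $c+(1,0)$ is a vertex of $\lambda$; $\lambda\setminus c$ is the induced subgraph with $c$ removed. A segment of $\lambda$ is a sequence $u_0,\dots,u_m$ ($m\ge0$) of interior vertices of $\lambda$ with each $u_i$ one step South or East of $u_{i-1}$; $s_{\mathrm{init}}=u_0$, $s_{\mathrm{term}}=u_m$. Segments $s,t$ are composable if $s_{\mathrm{term}}$ is one unit North or West of $t_{\mathrm{init}}$, and then $s\circ t$ is the concatenated segment. A set $X$ of segments of $\lambda$ is closed if $s,t\in X$ with $s,t$ composable implies $s\circ t\in X$; it is biclosed if both $X$ and its complement (in the set $S$ of all segments of $\lambda$) are closed. $\mathrm{Bic}(S)$ is the set of biclosed sets of segments of $\lambda$. -}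

module Defs where

open import Data.Integer using (ℤ; +_; -[1+_]; _+_; _≟_)
open import Data.Product using (_×_; _,_; proj₁; proj₂)
open import Data.Product.Properties using (≡-dec)
open import Data.Sum using (_⊎_)
open import Data.List using (List; []; _∷_; _++_; foldl; filter)
open import Data.List.Membership.Propositional using (_∈_)
open import Relation.Nullary using (¬_; ¬?)
open import Relation.Binary.PropositionalEquality using (_≡_)

-- Points of ℤ × ℤ: first coordinate = East, second = North.
Point : Set
Point = ℤ × ℤ

_≟P_ : (p q : Point) → Relation.Nullary.Dec (p ≡ q)
_≟P_ = ≡-dec _≟_ _≟_

_⊕_ : Point → Point → Point
(a , b) ⊕ (c , d) = (a + c , b + d)

-- A shape: a finite induced subgraph of the grid, determined by its
-- finite vertex set (given as a list).
Shape : Set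
Shape = List Point

Vertex : Shape → Point → Set
Vertex λ' v = v ∈ λ'

offsets : List ℤ
offsets = -[1+ 0 ] ∷ + 0 ∷ + 1 ∷ []

Interior : Shape → Point → Set
Interior λ' v = ∀ a b → a ∈ offsets → b ∈ offsets → Vertex λ' (v ⊕ (a , b))

SECorner : Shape → Point → Set
SECorner λ' c = Vertex λ' c × ¬ Vertex λ' (c ⊕ (+ 0 , -[1+ 0 ])) × ¬ Vertex λ' (c ⊕ (+ 1 , + 0))

_∖_ : Shape → Point → Shape
λ' ∖ c = filter (λ v → ¬? (v ≟P c)) λ'

data Dir : Set where
  South East : Dir

move : Point → Dir → Point
move p South = p ⊕ (+ 0 , -[1+ 0 ])
move p East  = p ⊕ (+ 1 , + 0)

-- A sequence u₀,…,uₘ with each uᵢ one step South or East of uᵢ₋₁,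
-- encoded by u₀ and the list of steps (bijective encoding).
record Seq : Set where
  constructor seq
  field
    init  : Point
    steps : List Dir
open Seq public

term : Seq → Point
term s = foldl move (init s) (steps s)

AllVerts : (Point → Set) → Point → List Dir → Set
AllVerts P p []       = P p
AllVerts P p (d ∷ ds) = P p × AllVerts P (move p d) ds

IsSegment : Shape → Seq → Set
IsSegment λ' s = AllVerts (Interior λ') (init s) (steps s)

-- concatenation of s and t, where t_init = move (s_term) d
compose : Seq → Dir → Seq → Seq
compose s d t = seq (init s) (steps s ++ (d ∷ steps t))

SegSet : Set₁
SegSet = Seq → Set

-- X closed: s,t ∈ X composable (t_init one step South or East of s_term,
-- i.e. s_term one unit North or West of t_init) ⇒ s∘t ∈ X
Closed : SegSet → Set
Closed X = ∀ s t d → X s → X t → init t ≡ move (term s) d → X (compose s d t)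

Compl : Shape → SegSet → SegSet
Compl λ' X s = IsSegment λ' s × ¬ X s

Biclosed : Shape → SegSet → Set
Biclosed λ' X = (∀ s → X s → IsSegment λ' s) × Closed X × Closed (Compl λ' X)

restrict : Shape → Point → SegSet → SegSet
restrict λ' c X s = X s × IsSegment (λ' ∖ c) s

module Submission where

-- Being a segment only asks that every vertex of the sequence be interior,
-- and interiority is monotone in the shape: if μ ⊆ λ then every interior
-- vertex of μ is interior in λ, hence every segment of μ is a segment of λ.
-- The proof therefore works for an arbitrary sub-shape μ ⊆ λ, not only for
-- μ = λ ∖ c with c a SE-corner:
--   * segments of a fixed shape are closed under composition, because
--     "all vertices satisfy P" is preserved by concatenating step lists;
--   * X ∩ Seg(μ) is closed, as an intersection of two closed sets;
--   * its complement Seg(μ) ∖ X is closed, since two segments of μ lying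
--     outside X are segments of λ outside X, so their composite lies outside
--     X by closedness of the complement in λ, and is a segment of μ.
-- The theorem is the special case μ = λ ∖ c, which is a sub-shape of λ
-- because it is obtained by filtering the vertex list of λ.

open import Defs
open import Data.Product using (_×_; _,_; proj₁; proj₂)
open import Data.List using ([]; _∷_; _++_; foldl)
open import Data.List.Relation.Binary.Subset.Propositional using (_⊆_)
open import Data.List.Relation.Binary.Subset.Propositional.Properties using (filter-⊆)
open import Relation.Nullary using (¬?)
open import Relation.Binary.PropositionalEquality using (_≡_; refl)

AllVerts-mono : {P Q : Point → Set} → (∀ p → P p → Q p) →
                ∀ p ds → AllVerts P p ds → AllVerts Q p ds
AllVerts-mono f p []       Pp         = f p Pp
AllVerts-mono f p (d ∷ ds) (Pp , Pds) = f p Pp , AllVerts-mono f (move p d) ds Pds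

AllVerts-++ : {P : Point → Set} → ∀ p ds d es →
              AllVerts P p ds → AllVerts P (move (foldl move p ds) d) es →
              AllVerts P p (ds ++ (d ∷ es))
AllVerts-++ p []       d es Pp         Pes = Pp , Pes
AllVerts-++ p (x ∷ xs) d es (Pp , Pxs) Pes = Pp , AllVerts-++ (move p x) xs d es Pxs Pes

compose-isSegment : ∀ μ s d t → IsSegment μ s → IsSegment μ t →
                    init t ≡ move (term s) d → IsSegment μ (compose s d t)
compose-isSegment μ (seq i ss) d (seq .(move (foldl move i ss) d) ts) Ss St refl =
  AllVerts-++ i ss d ts Ss St

interior-mono : ∀ {μ λ'} → μ ⊆ λ' → ∀ v → Interior μ v → Interior λ' v
interior-mono μ⊆λ v int a b a∈ b∈ = μ⊆λ (int a b a∈ b∈)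

isSegment-mono : ∀ {μ λ'} → μ ⊆ λ' → ∀ s → IsSegment μ s → IsSegment λ' s
isSegment-mono μ⊆λ s = AllVerts-mono (interior-mono μ⊆λ) (init s) (steps s)

restrictTo : Shape → SegSet → SegSet
restrictTo μ X s = X s × IsSegment μ s

restrictTo-biclosed : ∀ {λ' μ} X → μ ⊆ λ' → Biclosed λ' X →
                      Biclosed μ (restrictTo μ X)
restrictTo-biclosed {λ'} {μ} X μ⊆λ (_ , X-closed , Xᶜ-closed) =
  (λ _ → proj₂) , restrict-closed , complement-closed
  where
  restrict-closed : Closed (restrictTo μ X)
  restrict-closed s t d (Xs , Ss) (Xt , St) eq =
    X-closed s t d Xs Xt eq , compose-isSegment μ s d t Ss St eq

  lift : ∀ u → Compl μ (restrictTo μ X) u → Compl λ' X u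
  lift u (Su , u∉) = isSegment-mono μ⊆λ u Su , λ Xu → u∉ (Xu , Su)

  complement-closed : Closed (Compl μ (restrictTo μ X))
  complement-closed s t d cs@(Ss , _) ct@(St , _) eq =
    compose-isSegment μ s d t Ss St eq ,
    λ Xst → proj₂ (Xᶜ-closed s t d (lift s cs) (lift t ct) eq) (proj₁ Xst)

-- Lemma 6.3.
lemma6p3 : (λ' : Shape) (X : SegSet) (c : Point) →
           Biclosed λ' X → SECorner λ' c →
           Biclosed (λ' ∖ c) (restrict λ' c X)
lemma6p3 λ' X c bic _ =
  restrictTo-biclosed X (filter-⊆ (λ v → ¬? (v ≟P c)) λ') bic
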